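{- For each integer $\ell\geq 3$, \[\mathfrak K(3\cdot 2^{\ell-2}+1)>\frac{5\cdot 2^{2\ell-3}}{3\cdot 2^{\ell-2}+1}\qquad\text{and}\qquad \mathfrak K(2^{\ell-1}+3)>\frac{2^{2\ell-2}}{2^{\ell-1}+3}.\]
   Context: The Thue-Morse word is the infinite binary word ${\bf t}={\bf t}_1{\bf t}_2{\bf t}_3\cdots$, where ${\bf t}_i\in\{0,1\}$ has the same parity as the number of $1$'s in the binary expansion of $i-1$. A $k$-anti-power is a word of the form $w_1w_2\cdots w_k$ where $w_1,\ldots,w_k$ are pairwise distinct words all of the same length. For a positive integer $m$, $\mathfrak K(m)$ denotes the smallest positive integer $k$ such that the prefix of ${\bf t}$ of length $km$ is not a $k$-anti-power. -}

module Defs where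

open import Data.Nat using (ℕ; zero; suc; _+_; _*_; _<_; _≤_)
open import Data.Nat.Base using (_/_; _%_)
open import Data.Bool using (Bool; true; false; not)
open import Data.List using (List; []; _∷_)
open import Data.Product using (_×_)
open import Relation.Binary.PropositionalEquality using (_≡_)
open import Relation.Nullary using (¬_)

popParity′ : ℕ → ℕ → Bool
popParity′ zero    n = false
popParity′ (suc f) zero = false
popParity′ (suc f) n@(suc _) with n % 2
... | zero  = popParity′ f (n / 2)
... | suc _ = not (popParity′ f (n / 2))

-- thueMorse n = t_{n+1} : true ↔ 1, i.e. parity of popcount of n
thueMorse : ℕ → Bool
thueMorse n = popParity′ n n

factor : ℕ → ℕ → List Bool
factor p zero      = []
factor p (suc len) = thueMorse p ∷ factor (suc p) len

block : ℕ → ℕ → List Bool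
block m i = factor (i * m) m

IsAntiPower : ℕ → ℕ → Set
IsAntiPower k m = ∀ i j → i < k → j < k → block m i ≡ block m j → i ≡ j

-- K is 𝔎(m): smallest positive k such that the prefix of length k m
-- is not a k-anti-power
IsK : ℕ → ℕ → Set
IsK m K = 1 ≤ K × ¬ IsAntiPower K m × (∀ k → 1 ≤ k → k < K → IsAntiPower k m)

-- Let t be the Thue–Morse word, P = 2 ^ (k + 1) and m odd. Equal factors of t of length at least
-- 3 · 2 ^ k + 1 occur at positions congruent modulo P: equal factors of length 4 start at positions
-- of the same parity (otherwise t would contain a cube), and halving both positions halves the
-- length that is needed. So if blocks i < j of length m coincide, P divides (j − i) · m and hence
-- j − i. If j − i ≥ 2P the prefix is already longer than the claimed bound. If j − i = P, writing
-- i · m = r + P · lo turns the coincidence into an agreement of t at lo and lo + m on a few letters,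
-- which a direct computation excludes: for m = 3 · 2 ^ (ℓ − 2) + 1 one has t (2w + m) = ¬ t (2w),
-- and for m = 2 ^ (ℓ − 1) + 3 agreement at x forces t (x + 3) ≠ t x at three consecutive x, while
-- every three consecutive positions contain an x with t (x + 3) = t x. Hence the first repeated
-- block, which determines 𝔎(m), lies beyond the bound.

module Submission where

open import Defs
open import Data.Bool using (Bool; true; false; not; _xor_)
open import Data.Bool.Properties
  using (_≟_; not-injective; not-¬; ¬-not; not-involutive; xor-identityʳ; xor-comm; not-distribʳ-xor)
open import Data.Empty using (⊥; ⊥-elim)
open import Data.Nat using (ℕ; NonZero; zero; suc; _+_; _*_; _∸_; _^_; _<_; _≤_; z≤n; s≤s; _<?_)
open import Data.Nat.DivMod
  using (_%_; _/_; m≡m%n+[m/n]*n; m%n<n; m/n<m; m*n%n≡0; m*n/n≡m; [m+kn]%n≡m%n; +-distrib-/-∣ʳ)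
open import Data.Nat.Divisibility
  using (_∣_; _∤_; divides; divides-refl; quotient; m∣n⇒n≡quotient*m; 1∣_; ∣1⇒≡1; ∣m+n∣m⇒∣n; m∣m*n;
         m*n∣⇒m∣; *-monoʳ-∣; *-cancelˡ-∣)
open import Data.Nat.Primality using (euclidsLemma; prime[2])
open import Data.Sum using (_⊎_; inj₁; inj₂)
open import Data.Nat.Properties
  using (≤-refl; ≤-reflexive; ≤-trans; ≤-pred; <-trans; <-≤-trans; ≤-<-trans; <⇒≤; <⇒≢; <⇒≱; ≮⇒≥; <-cmp;
         n<1+n; m≤m+n; m≤n+m; m<m+n; m<n+m; m+n≤o⇒m≤o; m≤n⇒∃[o]m+o≡n; m+[n∸m]≡n; [m+n]∸[m+o]≡n∸o;
         +-comm; +-assoc; +-suc; +-identityʳ; +-mono-≤; +-monoˡ-≤; +-monoʳ-≤; +-cancelˡ-<; +-cancelʳ-<;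
         *-comm; *-suc; *-identityˡ; *-distribˡ-∸; *-distribʳ-∸; *-monoˡ-≤; *-monoʳ-≤; *-cancelˡ-<;
         m^n>0; m^n≢0; ^-distribˡ-+-*; ^-monoʳ-<; anyUpTo?; module ≤-Reasoning)
open import Data.Nat.Tactic.RingSolver using (solve-∀)
open import Data.List using (_∷_)
open import Data.List.Properties using (∷-injective; ≡-dec)
open import Data.Product using (_×_; _,_; proj₁; proj₂; ∃-syntax)
open import Relation.Binary.PropositionalEquality
  using (_≡_; _≢_; refl; sym; trans; cong; cong₂; subst; subst₂; module ≡-Reasoning)
open import Function using (_∘_)
open import Relation.Binary.Definitions using (tri<; tri≈; tri>)
open import Relation.Nullary using (¬_; Dec; yes; no)

tm : ℕ → Bool
tm = thueMorse

[1+n]/2≤n : ∀ n → suc n / 2 ≤ n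
[1+n]/2≤n n = ≤-pred (m/n<m (suc n) 2 (s≤s (s≤s z≤n)))

popParity′-0 : ∀ f → popParity′ f 0 ≡ false
popParity′-0 zero    = refl
popParity′-0 (suc _) = refl

popParity′-fuel : ∀ f g n → n ≤ f → n ≤ g → popParity′ f n ≡ popParity′ g n
popParity′-fuel f       g       zero    _         _         = trans (popParity′-0 f) (sym (popParity′-0 g))
popParity′-fuel (suc f) (suc g) (suc n) (s≤s n≤f) (s≤s n≤g) with suc n % 2
... | zero  =          popParity′-fuel f g (suc n / 2) (≤-trans ([1+n]/2≤n n) n≤f) (≤-trans ([1+n]/2≤n n) n≤g)
... | suc _ = cong not (popParity′-fuel f g (suc n / 2) (≤-trans ([1+n]/2≤n n) n≤f) (≤-trans ([1+n]/2≤n n) n≤g))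

popParity′-even : ∀ f n → suc n % 2 ≡ 0 → popParity′ (suc f) (suc n) ≡ popParity′ f (suc n / 2)
popParity′-even f n e  with suc n % 2
popParity′-even f n e  | zero  = refl
popParity′-even f n () | suc _

popParity′-odd : ∀ f n → suc n % 2 ≡ 1 → popParity′ (suc f) (suc n) ≡ not (popParity′ f (suc n / 2))
popParity′-odd f n e  with suc n % 2
popParity′-odd f n () | zero
popParity′-odd f n e  | suc _ = refl

tm[2x]≡tm[x] : ∀ x → tm (2 * x) ≡ tm x
tm[2x]≡tm[x] zero         = refl
tm[2x]≡tm[x] x@(suc x′)   = begin
  popParity′ (suc n) (suc n)  ≡⟨ popParity′-even n n (trans (cong (_% 2) 2x≡x*2) (m*n%n≡0 x 2)) ⟩
  popParity′ n (suc n / 2)    ≡⟨ cong (popParity′ n) (trans (cong (_/ 2) 2x≡x*2) (m*n/n≡m x 2)) ⟩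
  popParity′ n x              ≡⟨ popParity′-fuel n x x (≤-trans (m≤m+n x 0) (m≤n+m (x + 0) x′)) ≤-refl ⟩
  tm x                        ∎
  where
  open ≡-Reasoning
  n = x′ + 1 * x
  2x≡x*2 : 2 * x ≡ x * 2
  2x≡x*2 = *-comm 2 x

tm[1+2x]≡not-tm[x] : ∀ x → tm (1 + 2 * x) ≡ not (tm x)
tm[1+2x]≡not-tm[x] x = begin
  popParity′ (suc n) (suc n)    ≡⟨ popParity′-odd n n (trans (cong (_% 2) 1+2x≡1+x*2) ([m+kn]%n≡m%n 1 x 2)) ⟩
  not (popParity′ n (suc n / 2)) ≡⟨ cong (not ∘ popParity′ n) (trans (cong (_/ 2) 1+2x≡1+x*2) half) ⟩
  not (popParity′ n x)          ≡⟨ cong not (popParity′-fuel n x x (m≤m+n x (x + 0)) ≤-refl) ⟩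
  not (tm x)                    ∎
  where
  open ≡-Reasoning
  n = 2 * x
  1+2x≡1+x*2 : 1 + 2 * x ≡ 1 + x * 2
  1+2x≡1+x*2 = cong suc (*-comm 2 x)
  half : (1 + x * 2) / 2 ≡ x
  half = trans (+-distrib-/-∣ʳ 1 {d = 2} (divides-refl x)) (m*n/n≡m x 2)

tm[1+2x]≡not-tm[2x] : ∀ x → tm (1 + 2 * x) ≡ not (tm (2 * x))
tm[1+2x]≡not-tm[2x] x = trans (tm[1+2x]≡not-tm[x] x) (cong not (sym (tm[2x]≡tm[x] x)))

data EvenOdd : ℕ → Set where
  even : ∀ x → EvenOdd (2 * x)
  odd  : ∀ x → EvenOdd (1 + 2 * x)

evenOdd : ∀ n → EvenOdd n
evenOdd zero = even 0
evenOdd (suc n) with evenOdd n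
... | even x = odd x
... | odd x  = subst EvenOdd (*-suc 2 x) (even (suc x))

tm-split : ∀ k r q → r < 2 ^ k → tm (r + 2 ^ k * q) ≡ tm q xor tm r
tm-split zero zero    q _         = trans (cong tm (*-identityˡ q)) (sym (xor-identityʳ (tm q)))
tm-split zero (suc r) q (s≤s ())
tm-split (suc k) r q r<2^[1+k] with evenOdd r
... | even r′ = begin
  tm (2 * r′ + 2 ^ suc k * q)   ≡⟨ cong tm (double r′ (2 ^ k) q) ⟩
  tm (2 * (r′ + 2 ^ k * q))     ≡⟨ tm[2x]≡tm[x] (r′ + 2 ^ k * q) ⟩
  tm (r′ + 2 ^ k * q)           ≡⟨ tm-split k r′ q (*-cancelˡ-< 2 r′ (2 ^ k) r<2^[1+k]) ⟩
  tm q xor tm r′                ≡⟨ cong (tm q xor_) (tm[2x]≡tm[x] r′) ⟨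
  tm q xor tm (2 * r′)          ∎
  where
  open ≡-Reasoning
  double : ∀ r P q → 2 * r + 2 * P * q ≡ 2 * (r + P * q)
  double = solve-∀
... | odd r′ = begin
  tm (1 + 2 * r′ + 2 ^ suc k * q)   ≡⟨ cong tm (double+1 r′ (2 ^ k) q) ⟩
  tm (1 + 2 * (r′ + 2 ^ k * q))     ≡⟨ tm[1+2x]≡not-tm[x] (r′ + 2 ^ k * q) ⟩
  not (tm (r′ + 2 ^ k * q))         ≡⟨ cong not (tm-split k r′ q (*-cancelˡ-< 2 r′ (2 ^ k) (<-trans (n<1+n _) r<2^[1+k]))) ⟩
  not (tm q xor tm r′)              ≡⟨ not-distribʳ-xor (tm q) (tm r′) ⟩
  tm q xor not (tm r′)              ≡⟨ cong (tm q xor_) (tm[1+2x]≡not-tm[x] r′) ⟨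
  tm q xor tm (1 + 2 * r′)          ∎
  where
  open ≡-Reasoning
  double+1 : ∀ r P q → 1 + 2 * r + 2 * P * q ≡ 1 + 2 * (r + P * q)
  double+1 = solve-∀

xor-cancelʳ : ∀ c {a b} → a xor c ≡ b xor c → a ≡ b
xor-cancelʳ false {a} {b} eq = trans (sym (xor-identityʳ a)) (trans eq (xor-identityʳ b))
xor-cancelʳ true  {a} {b} eq = not-injective (trans (xor-comm true a) (trans eq (xor-comm b true)))

tm-cube-free : ∀ n → tm n ≡ tm (1 + n) → tm (1 + n) ≡ tm (2 + n) → ⊥
tm-cube-free n eq₁ eq₂ with evenOdd n
... | even x = not-¬ refl (trans eq₁ (tm[1+2x]≡not-tm[2x] x))
... | odd x  = not-¬ refl (begin
  tm (2 + 2 * x)          ≡⟨ eq₂ ⟩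
  tm (3 + 2 * x)          ≡⟨ cong (tm ∘ suc) (*-suc 2 x) ⟨
  tm (1 + 2 * (1 + x))    ≡⟨ tm[1+2x]≡not-tm[2x] (1 + x) ⟩
  not (tm (2 * (1 + x)))  ≡⟨ cong (not ∘ tm) (*-suc 2 x) ⟩
  not (tm (2 + 2 * x))    ∎)
  where open ≡-Reasoning

subst-tm : ∀ {a b a′ b′} → a ≡ a′ → b ≡ b′ → tm a ≡ tm b → tm a′ ≡ tm b′
subst-tm refl refl eq = eq

SameFactor : ℕ → ℕ → ℕ → Set
SameFactor L a b = ∀ s → s < L → tm (a + s) ≡ tm (b + s)

SameFactor-≤ : ∀ {L L′ a b} → L ≤ L′ → SameFactor L′ a b → SameFactor L a b
SameFactor-≤ L≤L′ agree s s<L = agree s (<-≤-trans s<L L≤L′)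

SameFactor-at : ∀ {L} a b s {a′ b′} → SameFactor L a b → s < L → a + s ≡ a′ → b + s ≡ b′ →
                tm a′ ≡ tm b′
SameFactor-at a b s agree s<L a+s≡a′ b+s≡b′ = subst-tm a+s≡a′ b+s≡b′ (agree s s<L)

factor≡⇒SameFactor : ∀ L a b → factor a L ≡ factor b L → SameFactor L a b
factor≡⇒SameFactor (suc L) a b eq zero _ =
  subst-tm (sym (+-identityʳ a)) (sym (+-identityʳ b)) (proj₁ (∷-injective eq))
factor≡⇒SameFactor (suc L) a b eq (suc s) (s≤s s<L) =
  subst-tm (sym (+-suc a s)) (sym (+-suc b s)) (factor≡⇒SameFactor L (suc a) (suc b) (proj₂ (∷-injective eq)) s s<L)

SameFactor⇒factor≡ : ∀ L a b → SameFactor L a b → factor a L ≡ factor b L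
SameFactor⇒factor≡ zero    a b agree = refl
SameFactor⇒factor≡ (suc L) a b agree = cong₂ _∷_ first rest
  where
  first : tm a ≡ tm b
  first = subst-tm (+-identityʳ a) (+-identityʳ b) (agree 0 (s≤s z≤n))
  rest : factor (suc a) L ≡ factor (suc b) L
  rest = SameFactor⇒factor≡ L (suc a) (suc b) λ s s<L →
    subst-tm (+-suc a s) (+-suc b s) (agree (suc s) (s≤s s<L))

mixed-parity : ∀ x y → ¬ SameFactor 4 (2 * x) (1 + 2 * y)
mixed-parity x y agree = tm-cube-free y y≈1+y 1+y≈2+y
  where
  open ≡-Reasoning
  a = 2 * x
  b = 1 + 2 * y
  a+2 : ∀ x → 2 * x + 2 ≡ 2 * (1 + x)
  a+2 = solve-∀
  a+3 : ∀ x → 2 * x + 3 ≡ 1 + 2 * (1 + x)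
  a+3 = solve-∀
  b+1 : ∀ y → 1 + 2 * y + 1 ≡ 2 * (1 + y)
  b+1 = solve-∀
  b+2 : ∀ y → 1 + 2 * y + 2 ≡ 1 + 2 * (1 + y)
  b+2 = solve-∀
  b+3 : ∀ y → 1 + 2 * y + 3 ≡ 2 * (2 + y)
  b+3 = solve-∀
  y≈1+y : tm y ≡ tm (1 + y)
  y≈1+y = begin
    tm y                    ≡⟨ not-involutive (tm y) ⟨
    not (not (tm y))        ≡⟨ cong not (tm[1+2x]≡not-tm[x] y) ⟨
    not (tm (1 + 2 * y))    ≡⟨ cong not (SameFactor-at a b 0 agree (s≤s z≤n) (+-identityʳ a) (+-identityʳ b)) ⟨
    not (tm (2 * x))        ≡⟨ tm[1+2x]≡not-tm[2x] x ⟨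
    tm (1 + 2 * x)          ≡⟨ SameFactor-at a b 1 agree (s≤s (s≤s z≤n)) (+-comm a 1) (b+1 y) ⟩
    tm (2 * (1 + y))        ≡⟨ tm[2x]≡tm[x] (1 + y) ⟩
    tm (1 + y)              ∎
  1+y≈2+y : tm (1 + y) ≡ tm (2 + y)
  1+y≈2+y = begin
    tm (1 + y)                   ≡⟨ not-involutive (tm (1 + y)) ⟨
    not (not (tm (1 + y)))       ≡⟨ cong not (tm[1+2x]≡not-tm[x] (1 + y)) ⟨
    not (tm (1 + 2 * (1 + y)))   ≡⟨ cong not (SameFactor-at a b 2 agree (s≤s (s≤s (s≤s z≤n))) (a+2 x) (b+2 y)) ⟨
    not (tm (2 * (1 + x)))       ≡⟨ tm[1+2x]≡not-tm[2x] (1 + x) ⟨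
    tm (1 + 2 * (1 + x))         ≡⟨ SameFactor-at a b 3 agree ≤-refl (a+3 x) (b+3 y) ⟩
    tm (2 * (2 + y))             ≡⟨ tm[2x]≡tm[x] (2 + y) ⟩
    tm (2 + y)                   ∎

data SameParity : ℕ → ℕ → Set where
  same : ∀ r x y → r < 2 → SameParity (r + 2 * x) (r + 2 * y)

sameParity : ∀ a b → SameFactor 4 a b → SameParity a b
sameParity a b agree with evenOdd a | evenOdd b
... | even x | even y = same 0 x y (s≤s z≤n)
... | odd x  | odd y  = same 1 x y ≤-refl
... | even x | odd y  = ⊥-elim (mixed-parity x y agree)
... | odd x  | even y = ⊥-elim (mixed-parity y x λ s s<4 → sym (agree s s<4))

SameFactor-quotient : ∀ e {n L} r q q′ → r < 2 ^ e → 2 ^ e * n < L →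
                 SameFactor L (r + 2 ^ e * q) (r + 2 ^ e * q′) → SameFactor (suc n) q q′
SameFactor-quotient e r q q′ r<2^e 2^e*n<L agree s s<1+n = xor-cancelʳ (tm r) (begin
  tm (q + s) xor tm r           ≡⟨ tm-split e r (q + s) r<2^e ⟨
  tm (r + 2 ^ e * (q + s))      ≡⟨ cong tm (regroup r (2 ^ e) q s) ⟨
  tm (r + 2 ^ e * q + 2 ^ e * s)  ≡⟨ agree (2 ^ e * s) (≤-<-trans (*-monoʳ-≤ (2 ^ e) (≤-pred s<1+n)) 2^e*n<L) ⟩
  tm (r + 2 ^ e * q′ + 2 ^ e * s) ≡⟨ cong tm (regroup r (2 ^ e) q′ s) ⟩
  tm (r + 2 ^ e * (q′ + s))     ≡⟨ tm-split e r (q′ + s) r<2^e ⟩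
  tm (q′ + s) xor tm r          ∎)
  where
  open ≡-Reasoning
  regroup : ∀ r P q s → r + P * q + P * s ≡ r + P * (q + s)
  regroup = solve-∀

∣-double-∸ : ∀ r x y {d} → d ∣ y ∸ x → 2 * d ∣ (r + 2 * y) ∸ (r + 2 * x)
∣-double-∸ r x y {d} d∣y∸x = subst (2 * d ∣_) (begin
  2 * (y ∸ x)                 ≡⟨ *-distribˡ-∸ 2 y x ⟩
  2 * y ∸ 2 * x               ≡⟨ [m+n]∸[m+o]≡n∸o r (2 * y) (2 * x) ⟨
  (r + 2 * y) ∸ (r + 2 * x)   ∎) (*-monoʳ-∣ 2 d∣y∸x)
  where open ≡-Reasoning

SameFactor⇒2^[1+k]∣b∸a : ∀ k a b → SameFactor (suc (3 * 2 ^ k)) a b → 2 ^ suc k ∣ b ∸ a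
SameFactor⇒2^[1+k]∣b∸a k a b agree with sameParity a b (SameFactor-≤ {a = a} {b} (s≤s (*-monoʳ-≤ 3 (m^n>0 2 k))) agree)
SameFactor⇒2^[1+k]∣b∸a zero    _ _ _     | same r x y _   = ∣-double-∸ r x y (1∣ (y ∸ x))
SameFactor⇒2^[1+k]∣b∸a (suc k) _ _ agree | same r x y r<2 =
  ∣-double-∸ r x y (SameFactor⇒2^[1+k]∣b∸a k x y
    (SameFactor-quotient 1 r x y r<2 (s≤s (≤-reflexive (regroup (2 ^ k)))) agree))
  where
  regroup : ∀ P → 2 * (3 * P) ≡ 3 * (2 * P)
  regroup = solve-∀

2^k∣d*m⇒2^k∣d : ∀ k {d m} → 2 ∤ m → 2 ^ k ∣ d * m → 2 ^ k ∣ d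
2^k∣d*m⇒2^k∣d zero    _   _ = 1∣ _
2^k∣d*m⇒2^k∣d (suc k) {d} {m} 2∤m 2^[1+k]∣dm with euclidsLemma d m prime[2] (m*n∣⇒m∣ 2 (2 ^ k) 2^[1+k]∣dm)
... | inj₂ 2∣m = ⊥-elim (2∤m 2∣m)
... | inj₁ (divides q refl) =
  subst (2 ^ suc k ∣_) (*-comm 2 q) (*-monoʳ-∣ 2 (2^k∣d*m⇒2^k∣d k {q} 2∤m 2^k∣qm))
  where
  regroup : ∀ q m → q * 2 * m ≡ 2 * (q * m)
  regroup = solve-∀
  2^k∣qm : 2 ^ k ∣ q * m
  2^k∣qm = *-cancelˡ-∣ {n = q * m} 2 (subst (2 ^ suc k ∣_) (regroup q m) 2^[1+k]∣dm)

period-descent : ∀ e {n m Q} x → 2 ^ e * n < m → x + 2 ^ e * m < 2 ^ e * Q →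
                 SameFactor m x (x + 2 ^ e * m) → ∃[ lo ] lo + m < Q × SameFactor (suc n) lo (lo + m)
period-descent e {n} {m} {Q} x 2^e*n<m bound agree =
  lo , lo+m<Q , SameFactor-quotient e r lo (lo + m) (m%n<n x P) 2^e*n<m (subst₂ (SameFactor m) x≡ x+Pm≡ agree)
  where
  P = 2 ^ e
  instance
    2^e≢0 : NonZero P
    2^e≢0 = m^n≢0 2 e
  r = x % P
  lo = x / P
  x≡ : x ≡ r + P * lo
  x≡ = trans (m≡m%n+[m/n]*n x P) (cong (r +_) (*-comm lo P))
  x+Pm≡ : x + P * m ≡ r + P * (lo + m)
  x+Pm≡ = trans (cong (_+ P * m) x≡) (regroup r P lo m)
    where
    regroup : ∀ r P lo m → r + P * lo + P * m ≡ r + P * (lo + m)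
    regroup = solve-∀
  lo+m<Q : lo + m < Q
  lo+m<Q = *-cancelˡ-< P (lo + m) Q (≤-<-trans (m≤n+m (P * (lo + m)) r) (subst (_< P * Q) x+Pm≡ bound))

blocks-distinct : ∀ k n m Q → 2 ∤ m → suc (3 * 2 ^ k) ≤ m → 2 ^ suc k * n < m → Q ≤ 2 * m →
                  (∀ lo → lo + m < Q → ¬ SameFactor (suc n) lo (lo + m)) →
                  ∀ i j → i < j → j * m < 2 ^ suc k * Q → block m i ≢ block m j
blocks-distinct k n m Q 2∤m long short Q≤2m no-repeat i j i<j j*m<P*Q eq =
  at-distance (quotient P∣j∸i) (trans (sym (m+[n∸m]≡n (<⇒≤ i<j))) (cong (i +_) (m∣n⇒n≡quotient*m P∣j∸i)))
  where
  P = 2 ^ suc k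
  agree : SameFactor m (i * m) (j * m)
  agree = factor≡⇒SameFactor m (i * m) (j * m) eq
  P∣j∸i : P ∣ j ∸ i
  P∣j∸i = 2^k∣d*m⇒2^k∣d (suc k) 2∤m
    (subst (P ∣_) (sym (*-distribʳ-∸ m j i))
      (SameFactor⇒2^[1+k]∣b∸a k (i * m) (j * m) (SameFactor-≤ {a = i * m} {j * m} long agree)))
  at-distance : ∀ c → j ≡ i + c * P → ⊥
  at-distance zero j≡i+0 = <⇒≢ i<j (sym (trans j≡i+0 (+-identityʳ i)))
  at-distance (suc zero) j≡i+P =
    let lo , lo+m<Q , repeat = period-descent (suc k) (i * m) short (subst (_< P * Q) j*m≡ j*m<P*Q)
                                               (subst (SameFactor m (i * m)) j*m≡ agree)
    in no-repeat lo lo+m<Q repeat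
    where
    regroup : ∀ i P m → (i + 1 * P) * m ≡ i * m + P * m
    regroup = solve-∀
    j*m≡ : j * m ≡ i * m + P * m
    j*m≡ = trans (cong (_* m) j≡i+P) (regroup i P m)
  at-distance (suc (suc c)) j≡i+[2+c]P = <⇒≱ j*m<P*Q (begin
    P * Q         ≤⟨ *-monoʳ-≤ P Q≤2m ⟩
    P * (2 * m)   ≡⟨ regroup P m ⟩
    2 * P * m     ≤⟨ *-monoˡ-≤ m 2P≤j ⟩
    j * m         ∎)
    where
    open ≤-Reasoning
    regroup : ∀ P m → P * (2 * m) ≡ 2 * P * m
    regroup = solve-∀
    2P≤j : 2 * P ≤ j
    2P≤j = subst (2 * P ≤_) (sym j≡i+[2+c]P) (≤-trans (*-monoˡ-≤ P (m≤m+n 2 c)) (m≤n+m _ i))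

tm[w+3*2^k]≡tm[w] : ∀ k w → w < 2 ^ suc k → tm (w + 3 * 2 ^ k) ≡ tm w
tm[w+3*2^k]≡tm[w] k w w<2^[1+k] with w <? 2 ^ k
... | yes w<2^k = trans (cong (tm ∘ (w +_)) (*-comm 3 (2 ^ k))) (tm-split k w 3 w<2^k)
... | no  w≮2^k with m≤n⇒∃[o]m+o≡n (≮⇒≥ w≮2^k)
...   | v , refl = begin
  tm (2 ^ k + v + 3 * 2 ^ k)  ≡⟨ cong tm (regroup₄ (2 ^ k) v) ⟩
  tm (v + 2 ^ k * 4)          ≡⟨ tm-split k v 4 v<2^k ⟩
  not (tm v)                  ≡⟨ tm-split k v 1 v<2^k ⟨
  tm (v + 2 ^ k * 1)          ≡⟨ cong tm (regroup₁ (2 ^ k) v) ⟨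
  tm (2 ^ k + v)              ∎
  where
  open ≡-Reasoning
  regroup₄ : ∀ P v → P + v + 3 * P ≡ v + P * 4
  regroup₄ = solve-∀
  regroup₁ : ∀ P v → P + v ≡ v + P * 1
  regroup₁ = solve-∀
  v<2^k : v < 2 ^ k
  v<2^k = +-cancelˡ-< (2 ^ k) v (2 ^ k) (subst (2 ^ k + v <_) (cong (2 ^ k +_) (+-identityʳ (2 ^ k))) w<2^[1+k])

tm[2w]≢tm[2w+3*2^[1+k]+1] : ∀ k w → w < 2 ^ suc k → tm (2 * w) ≢ tm (2 * w + (3 * 2 ^ suc k + 1))
tm[2w]≢tm[2w+3*2^[1+k]+1] k w w<2^[1+k] eq = not-¬ refl (begin
  tm (2 * w)                        ≡⟨ eq ⟩
  tm (2 * w + (3 * 2 ^ suc k + 1))  ≡⟨ cong tm (regroup w (2 ^ k)) ⟩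
  tm (1 + 2 * (w + 3 * 2 ^ k))      ≡⟨ tm[1+2x]≡not-tm[x] (w + 3 * 2 ^ k) ⟩
  not (tm (w + 3 * 2 ^ k))          ≡⟨ cong not (tm[w+3*2^k]≡tm[w] k w w<2^[1+k]) ⟩
  not (tm w)                        ≡⟨ cong not (tm[2x]≡tm[x] w) ⟨
  not (tm (2 * w))                  ∎)
  where
  open ≡-Reasoning
  regroup : ∀ w P → 2 * w + (3 * (2 * P) + 1) ≡ 1 + 2 * (w + 3 * P)
  regroup = solve-∀

no-repeat-at-3*2^[1+k]+1 : ∀ k lo → lo + 1 < 2 ^ (2 + k) → ¬ SameFactor 2 lo (lo + (3 * 2 ^ suc k + 1))
no-repeat-at-3*2^[1+k]+1 k lo bound agree with evenOdd lo
... | even w = tm[2w]≢tm[2w+3*2^[1+k]+1] k w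
  (*-cancelˡ-< 2 w (2 ^ suc k) (<-trans (n<1+n (2 * w)) (subst (_< 2 ^ (2 + k)) (+-comm (2 * w) 1) bound)))
  (SameFactor-at (2 * w) (2 * w + (3 * 2 ^ suc k + 1)) 0 agree (s≤s z≤n) (+-identityʳ _) (+-identityʳ _))
... | odd w = tm[2w]≢tm[2w+3*2^[1+k]+1] k (1 + w)
  (*-cancelˡ-< 2 (1 + w) (2 ^ suc k) (subst (_< 2 ^ (2 + k)) (next w) bound))
  (SameFactor-at (1 + 2 * w) (1 + 2 * w + (3 * 2 ^ suc k + 1)) 1 agree ≤-refl
                 (next w) (next+ w (3 * 2 ^ suc k + 1)))
  where
  next : ∀ w → 1 + 2 * w + 1 ≡ 2 * (1 + w)
  next = solve-∀
  next+ : ∀ w m → 1 + 2 * w + m + 1 ≡ 2 * (1 + w) + m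
  next+ = solve-∀

SameAt+3 : ℕ → Set
SameAt+3 x = tm (x + 3) ≡ tm x

module _ (a : ℕ) where
  private
    open ≡-Reasoning
    regroup₀ : ∀ a → 2 * (2 * a) ≡ 4 * a
    regroup₀ = solve-∀
    regroup₁ : ∀ a → 1 + 2 * (2 * a) ≡ 4 * a + 1
    regroup₁ = solve-∀
    regroup₂ : ∀ a → 2 * (1 + 2 * a) ≡ 4 * a + 2
    regroup₂ = solve-∀
    regroup₃ : ∀ a → 1 + 2 * (1 + 2 * a) ≡ 4 * a + 3
    regroup₃ = solve-∀

  tm[4a]≡tm[a] : tm (4 * a) ≡ tm a
  tm[4a]≡tm[a] = trans (cong tm (sym (regroup₀ a))) (trans (tm[2x]≡tm[x] (2 * a)) (tm[2x]≡tm[x] a))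

  tm[4a+1]≡not-tm[a] : tm (4 * a + 1) ≡ not (tm a)
  tm[4a+1]≡not-tm[a] = trans (cong tm (sym (regroup₁ a))) (trans (tm[1+2x]≡not-tm[x] (2 * a)) (cong not (tm[2x]≡tm[x] a)))

  tm[4a+2]≡not-tm[a] : tm (4 * a + 2) ≡ not (tm a)
  tm[4a+2]≡not-tm[a] = trans (cong tm (sym (regroup₂ a))) (trans (tm[2x]≡tm[x] (1 + 2 * a)) (tm[1+2x]≡not-tm[x] a))

  tm[4a+3]≡tm[a] : tm (4 * a + 3) ≡ tm a
  tm[4a+3]≡tm[a] = begin
    tm (4 * a + 3)              ≡⟨ cong tm (regroup₃ a) ⟨
    tm (1 + 2 * (1 + 2 * a))    ≡⟨ tm[1+2x]≡not-tm[x] (1 + 2 * a) ⟩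
    not (tm (1 + 2 * a))        ≡⟨ cong not (tm[1+2x]≡not-tm[x] a) ⟩
    not (not (tm a))            ≡⟨ not-involutive (tm a) ⟩
    tm a                        ∎

SameAt+3[4a] : ∀ a → SameAt+3 (4 * a)
SameAt+3[4a] a = trans (tm[4a+3]≡tm[a] a) (sym (tm[4a]≡tm[a] a))

SameAt+3[4a+1]⊎SameAt+3[4a+2] : ∀ a → SameAt+3 (4 * a + 1) ⊎ SameAt+3 (4 * a + 2)
SameAt+3[4a+1]⊎SameAt+3[4a+2] a with tm (1 + a) ≟ tm a
... | yes agree = inj₂ (begin
  tm (4 * a + 2 + 3)      ≡⟨ cong tm (regroup₅ a) ⟩
  tm (4 * (1 + a) + 1)    ≡⟨ tm[4a+1]≡not-tm[a] (1 + a) ⟩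
  not (tm (1 + a))        ≡⟨ cong not agree ⟩
  not (tm a)              ≡⟨ tm[4a+2]≡not-tm[a] a ⟨
  tm (4 * a + 2)          ∎)
  where
  open ≡-Reasoning
  regroup₅ : ∀ a → 4 * a + 2 + 3 ≡ 4 * (1 + a) + 1
  regroup₅ = solve-∀
... | no differ = inj₁ (begin
  tm (4 * a + 1 + 3)      ≡⟨ cong tm (regroup₄ a) ⟩
  tm (4 * (1 + a))        ≡⟨ tm[4a]≡tm[a] (1 + a) ⟩
  tm (1 + a)              ≡⟨ ¬-not differ ⟩
  not (tm a)              ≡⟨ tm[4a+1]≡not-tm[a] a ⟨
  tm (4 * a + 1)          ∎)
  where
  open ≡-Reasoning
  regroup₄ : ∀ a → 4 * a + 1 + 3 ≡ 4 * (1 + a)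
  regroup₄ = solve-∀

2^[2+k]≡4*2^k : ∀ k → 2 ^ (2 + k) ≡ 4 * 2 ^ k
2^[2+k]≡4*2^k k = regroup (2 ^ k)
  where
  regroup : ∀ P → 2 * (2 * P) ≡ 4 * P
  regroup = solve-∀

4a+[1+r]+3<4c⇒4[2+a]≤4c : ∀ a c r → 4 * a + suc r + 3 < 4 * c → 4 * (2 + a) ≤ 4 * c
4a+[1+r]+3<4c⇒4[2+a]≤4c a c r h =
  *-monoʳ-≤ 4 (*-cancelˡ-< 4 (1 + a) c (m+n≤o⇒m≤o (suc (4 * (1 + a))) (≤-trans (≤-reflexive (regroup a r)) h)))
  where
  regroup : ∀ a r → suc (4 * (1 + a)) + r ≡ suc (4 * a + suc r + 3)
  regroup = solve-∀

4a+r+e+3<4[2+a] : ∀ a r e → r + e ≤ 4 → 4 * a + r + e + 3 < 4 * (2 + a)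
4a+r+e+3<4[2+a] a r e r+e≤4 = begin-strict
  4 * a + r + e + 3        <⟨ n<1+n _ ⟩
  suc (4 * a + r + e + 3)  ≡⟨ regroup a r e ⟩
  4 * a + (r + e) + 4      ≤⟨ +-monoˡ-≤ 4 (+-monoʳ-≤ (4 * a) r+e≤4) ⟩
  4 * a + 4 + 4            ≡⟨ regroup′ a ⟩
  4 * (2 + a)              ∎
  where
  open ≤-Reasoning
  regroup : ∀ a r e → suc (4 * a + r + e + 3) ≡ 4 * a + (r + e) + 4
  regroup = solve-∀
  regroup′ : ∀ a → 4 * a + 4 + 4 ≡ 4 * (2 + a)
  regroup′ = solve-∀

tm-window-4a+r : ∀ c a r → r < 4 → 4 * a + r + 3 < 4 * c →
            ∃[ e ] e < 3 × 4 * a + r + e + 3 < 4 * c × SameAt+3 (4 * a + r + e)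
tm-window-4a+r c a 0 _ h =
  0 , s≤s z≤n , subst (λ x → x + 3 < 4 * c) (sym (+-identityʳ (4 * a + 0))) h , subst SameAt+3 (shift a) (SameAt+3[4a] a)
  where
  shift : ∀ a → 4 * a ≡ 4 * a + 0 + 0
  shift = solve-∀
tm-window-4a+r c a 1 _ h with SameAt+3[4a+1]⊎SameAt+3[4a+2] a
... | inj₁ at1 = 0 , s≤s z≤n , <-≤-trans (4a+r+e+3<4[2+a] a 1 0 (s≤s z≤n)) (4a+[1+r]+3<4c⇒4[2+a]≤4c a c 0 h)
               , subst SameAt+3 (sym (+-identityʳ (4 * a + 1))) at1
... | inj₂ at2 = 1 , s≤s (s≤s z≤n) , <-≤-trans (4a+r+e+3<4[2+a] a 1 1 (s≤s (s≤s z≤n))) (4a+[1+r]+3<4c⇒4[2+a]≤4c a c 0 h)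
               , subst SameAt+3 (sym (+-assoc (4 * a) 1 1)) at2
tm-window-4a+r c a 2 _ h = 2 , ≤-refl , <-≤-trans (4a+r+e+3<4[2+a] a 2 2 ≤-refl) (4a+[1+r]+3<4c⇒4[2+a]≤4c a c 1 h)
                    , subst SameAt+3 (shift a) (SameAt+3[4a] (1 + a))
  where
  shift : ∀ a → 4 * (1 + a) ≡ 4 * a + 2 + 2
  shift = solve-∀
tm-window-4a+r c a 3 _ h = 1 , s≤s (s≤s z≤n) , <-≤-trans (4a+r+e+3<4[2+a] a 3 1 ≤-refl) (4a+[1+r]+3<4c⇒4[2+a]≤4c a c 2 h)
                    , subst SameAt+3 (shift a) (SameAt+3[4a] (1 + a))
  where
  shift : ∀ a → 4 * (1 + a) ≡ 4 * a + 3 + 1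
  shift = solve-∀
tm-window-4a+r c a (suc (suc (suc (suc _)))) (s≤s (s≤s (s≤s (s≤s ())))) _

tm-window : ∀ c n → n + 3 < 4 * c → ∃[ e ] e < 3 × n + e + 3 < 4 * c × SameAt+3 (n + e)
tm-window c n = subst (λ n → n + 3 < 4 * c → ∃[ e ] e < 3 × n + e + 3 < 4 * c × SameAt+3 (n + e)) (sym n≡4a+r)
                      (tm-window-4a+r c (n / 4) (n % 4) (m%n<n n 4))
  where
  n≡4a+r : n ≡ 4 * (n / 4) + n % 4
  n≡4a+r = trans (m≡m%n+[m/n]*n n 4) (trans (+-comm (n % 4) _) (cong (_+ n % 4) (*-comm (n / 4) 4)))

no-repeat-at-2^[2+k]+3 : ∀ k lo → lo + 3 < 2 ^ (2 + k) → ¬ SameFactor 3 lo (lo + (2 ^ (2 + k) + 3))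
no-repeat-at-2^[2+k]+3 k lo bound agree with tm-window (2 ^ k) lo (subst (lo + 3 <_) (2^[2+k]≡4*2^k k) bound)
... | e , e<3 , lo+e+3<4*2^k , period = not-¬ refl (begin
  tm (lo + e)                   ≡⟨ agree e e<3 ⟩
  tm (lo + (N + 3) + e)         ≡⟨ cong tm (regroup lo e N) ⟩
  tm (lo + e + 3 + N * 1)       ≡⟨ tm-split (2 + k) (lo + e + 3) 1 lo+e+3<N ⟩
  not (tm (lo + e + 3))         ≡⟨ cong not period ⟩
  not (tm (lo + e))             ∎)
  where
  open ≡-Reasoning
  N = 2 ^ (2 + k)
  lo+e+3<N : lo + e + 3 < N
  lo+e+3<N = subst (lo + e + 3 <_) (sym (2^[2+k]≡4*2^k k)) lo+e+3<4*2^k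
  regroup : ∀ lo e N → lo + (N + 3) + e ≡ lo + e + 3 + N * 1
  regroup = solve-∀

n<2^n : ∀ n → n < 2 ^ n
n<2^n zero    = s≤s z≤n
n<2^n (suc n) = ≤-<-trans (n<2^n n) (^-monoʳ-< 2 (s≤s (s≤s z≤n)) (n<1+n n))

Repeats : ℕ → ℕ → Set
Repeats m j = ∃[ i ] i < j × block m i ≡ block m j

repeats? : ∀ m j → Dec (Repeats m j)
repeats? m j = anyUpTo? (λ i → ≡-dec _≟_ (block m i) (block m j)) j

Repeats-2^[1+m] : ∀ m → Repeats m (2 ^ suc m)
Repeats-2^[1+m] m =
  2 ^ m , ^-monoʳ-< 2 (s≤s (s≤s z≤n)) (n<1+n m) , SameFactor⇒factor≡ m (2 ^ m * m) (2 ^ suc m * m) agree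
  where
  open ≡-Reasoning
  agree : SameFactor m (2 ^ m * m) (2 ^ suc m * m)
  agree s s<m = begin
    tm (2 ^ m * m + s)            ≡⟨ cong tm (+-comm (2 ^ m * m) s) ⟩
    tm (s + 2 ^ m * m)            ≡⟨ tm-split m s m s<2^m ⟩
    tm m xor tm s                 ≡⟨ cong (_xor tm s) (tm[2x]≡tm[x] m) ⟨
    tm (2 * m) xor tm s           ≡⟨ tm-split m s (2 * m) s<2^m ⟨
    tm (s + 2 ^ m * (2 * m))      ≡⟨ cong tm (regroup s (2 ^ m) m) ⟩
    tm (2 ^ suc m * m + s)        ∎
    where
    s<2^m : s < 2 ^ m
    s<2^m = <-trans s<m (n<2^n m)
    regroup : ∀ s P m → s + P * (2 * m) ≡ 2 * P * m + s
    regroup = solve-∀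

least-witness : ∀ {P : ℕ → Set} → (∀ n → Dec (P n)) → ∀ n → ∃[ i ] i < n × P i →
                ∃[ j ] P j × (∀ k → k < j → ¬ P k)
least-witness P? (suc n) (i , i<1+n , Pi) with anyUpTo? P? n
... | yes below = least-witness P? n below
... | no  none  = i , Pi , λ k k<i Pk → none (k , <-≤-trans k<i (≤-pred i<1+n) , Pk)

IsAntiPower-below-first-repeat : ∀ {m j} → (∀ k → k < j → ¬ Repeats m k) → ∀ k → k ≤ j → IsAntiPower k m
IsAntiPower-below-first-repeat no-repeat k k≤j i i′ i<k i′<k eq with <-cmp i i′
... | tri< i<i′ _ _ = ⊥-elim (no-repeat i′ (<-≤-trans i′<k k≤j) (i , i<i′ , eq))
... | tri≈ _ i≡i′ _ = i≡i′
... | tri> _ _ i′<i = ⊥-elim (no-repeat i (<-≤-trans i<k k≤j) (i′ , i′<i , sym eq))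

𝔎-exists-above : ∀ m B → 0 < m → (∀ i j → i < j → j * m < B → block m i ≢ block m j) →
                 ∃[ K ] IsK m K × B < K * m
𝔎-exists-above m B 0<m distinct
  with least-witness (repeats? m) (suc (2 ^ suc m)) (2 ^ suc m , ≤-refl , Repeats-2^[1+m] m)
... | j , (i , i<j , eq) , first = suc j , (s≤s z≤n , not-anti-power , anti-power-below) , bound
  where
  not-anti-power : ¬ IsAntiPower (suc j) m
  not-anti-power anti = <⇒≢ i<j (anti i j (<-trans i<j ≤-refl) ≤-refl eq)
  anti-power-below : ∀ k → 1 ≤ k → k < suc j → IsAntiPower k m
  anti-power-below k _ k<1+j = IsAntiPower-below-first-repeat first k (≤-pred k<1+j)
  bound : B < suc j * m
  bound with B <? suc j * m
  ... | yes B<[1+j]m = B<[1+j]m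
  ... | no  B≮[1+j]m = ⊥-elim (distinct i j i<j (<-≤-trans (m<n+m (j * m) 0<m) (≮⇒≥ B≮[1+j]m)) eq)

2∤1+2n : ∀ {m} n → m ≡ 1 + 2 * n → 2 ∤ m
2∤1+2n n refl 2∣m with ∣1⇒≡1 (∣m+n∣m⇒∣n (subst (2 ∣_) (+-comm 1 (2 * n)) 2∣m) (m∣m*n n))
... | ()

≤-by : ∀ {x y} d → x + d ≡ y → x ≤ y
≤-by {x} d eq = m+n≤o⇒m≤o x (≤-reflexive eq)

𝔎[3*2^[1+k]+1] : ∀ k → ∃[ K ] IsK (3 * 2 ^ suc k + 1) K
                               × 2 ^ (2 + k) * (5 * 2 ^ suc k) < K * (3 * 2 ^ suc k + 1)
𝔎[3*2^[1+k]+1] k = 𝔎-exists-above m (2 ^ (2 + k) * Q) (≤-trans (s≤s z≤n) long)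
  (blocks-distinct (suc k) 1 m Q (2∤1+2n (3 * c) (m-odd c)) long (≤-by (2 * c) (short c))
                   (≤-by (2 * c + 2) (Q≤2m c)) no-repeat)
  where
  c = 2 ^ k
  m = 3 * 2 ^ suc k + 1
  Q = 5 * 2 ^ suc k
  long : suc (3 * 2 ^ suc k) ≤ m
  long = ≤-reflexive (+-comm 1 (3 * 2 ^ suc k))
  m-odd : ∀ c → 3 * (2 * c) + 1 ≡ 1 + 2 * (3 * c)
  m-odd = solve-∀
  short : ∀ c → suc (2 * (2 * c) * 1) + 2 * c ≡ 3 * (2 * c) + 1
  short = solve-∀
  Q≤2m : ∀ c → 5 * (2 * c) + (2 * c + 2) ≡ 2 * (3 * (2 * c) + 1)
  Q≤2m = solve-∀
  no-repeat : ∀ lo → lo + m < Q → ¬ SameFactor 2 lo (lo + m)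
  no-repeat lo lo+m<Q = no-repeat-at-3*2^[1+k]+1 k lo
    (+-cancelʳ-< (3 * 2 ^ suc k) (lo + 1) (2 ^ (2 + k))
      (subst₂ _<_ (regroup lo (2 ^ suc k)) (regroup′ (2 ^ suc k)) lo+m<Q))
    where
    regroup : ∀ lo P → lo + (3 * P + 1) ≡ lo + 1 + 3 * P
    regroup = solve-∀
    regroup′ : ∀ P → 5 * P ≡ 2 * P + 3 * P
    regroup′ = solve-∀

𝔎[2^[2+k]+3] : ∀ k → ∃[ K ] IsK (2 ^ (2 + k) + 3) K × 2 ^ suc k * 2 ^ (3 + k) < K * (2 ^ (2 + k) + 3)
𝔎[2^[2+k]+3] k = 𝔎-exists-above m (2 ^ suc k * Q) (≤-trans (s≤s z≤n) long)
  (blocks-distinct k 2 m Q (2∤1+2n (2 * c + 1) (m-odd c)) long (≤-by 2 (short c)) (≤-by 6 (Q≤2m c)) no-repeat)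
  where
  c = 2 ^ k
  N = 2 ^ (2 + k)
  m = N + 3
  Q = 2 ^ (3 + k)
  m-odd : ∀ c → 2 * (2 * c) + 3 ≡ 1 + 2 * (2 * c + 1)
  m-odd = solve-∀
  long : suc (3 * 2 ^ k) ≤ m
  long = ≤-by (c + 2) (regroup c)
    where
    regroup : ∀ c → suc (3 * c) + (c + 2) ≡ 2 * (2 * c) + 3
    regroup = solve-∀
  short : ∀ c → suc (2 * c * 2) + 2 ≡ 2 * (2 * c) + 3
  short = solve-∀
  Q≤2m : ∀ c → 2 * (2 * (2 * c)) + 6 ≡ 2 * (2 * (2 * c) + 3)
  Q≤2m = solve-∀
  no-repeat : ∀ lo → lo + m < Q → ¬ SameFactor 3 lo (lo + m)
  no-repeat lo lo+m<Q = no-repeat-at-2^[2+k]+3 k lo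
    (+-cancelʳ-< N (lo + 3) N (subst₂ _<_ (regroup lo N) (regroup′ N) lo+m<Q))
    where
    regroup : ∀ lo N → lo + (N + 3) ≡ lo + 3 + N
    regroup = solve-∀
    regroup′ : ∀ N → 2 * N ≡ N + N
    regroup′ = solve-∀

lemma9 : ∀ (ℓ : ℕ) → 3 ≤ ℓ →
    (∃[ K ] (IsK (3 * 2 ^ (ℓ ∸ 2) + 1) K
              × 5 * 2 ^ (2 * ℓ ∸ 3) < K * (3 * 2 ^ (ℓ ∸ 2) + 1)))
    × (∃[ K ] (IsK (2 ^ (ℓ ∸ 1) + 3) K
              × 2 ^ (2 * ℓ ∸ 2) < K * (2 ^ (ℓ ∸ 1) + 3)))
lemma9 (suc (suc (suc k))) (s≤s (s≤s (s≤s _))) =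
  with-bound (trans (cong (5 *_) (power (2 + k) (1 + k) (exponent₁ k))) (regroup (2 ^ (2 + k)) (2 ^ suc k)))
             (𝔎[3*2^[1+k]+1] k) ,
  with-bound (power (1 + k) (3 + k) (exponent₂ k)) (𝔎[2^[2+k]+3] k)
  where
  with-bound : ∀ {m B B′} → B ≡ B′ → ∃[ K ] IsK m K × B′ < K * m → ∃[ K ] IsK m K × B < K * m
  with-bound refl K = K
  power : ∀ a b {e} → e ≡ a + b → 2 ^ e ≡ 2 ^ a * 2 ^ b
  power a b refl = ^-distribˡ-+-* 2 a b
  exponent₁ : ∀ k → k + (3 + k + 0) ≡ 2 + k + (1 + k)
  exponent₁ = solve-∀
  exponent₂ : ∀ k → suc (k + (3 + k + 0)) ≡ 1 + k + (3 + k)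
  exponent₂ = solve-∀
  regroup : ∀ A B → 5 * (A * B) ≡ A * (5 * B)
  regroup = solve-∀
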